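{- For each $n\ge0$ and $e\in\mathbf{I}_n(\underline{01}0)$, assign the label $L(e)=(a,b)=(|A_{>}(e)|,|B_{\le}(e)|)$. Then the empty sequence has label $(0,1)$, and if $e\in\mathbf{I}_n(\underline{01}0)$ has label $(a,b)$, then the multiset of labels $\{L(eh): h\text{ an active site of } e\}$ equals the multiset consisting of $(a+1-i,\,b-1+i)$ for $i=1,\dots,a$ together with $(a+b+1-i,\,i)$ for $i=1,\dots,b$; that is, $(a,b),(a-1,b+1),\dots,(1,b+a-1),(a+b,1),(a+b-1,2),\dots,(a+1,b)$.
   Context: $\mathbf{I}_n$ is the set of integer sequences $e_1\dots e_n$ with $0\le e_i<i$; $\mathbf{I}_n(\underline{01}0)$ is the set of $e\in\mathbf{I}_n$ with no positions $i,k$, $i+1<k$, with $e_i=e_k<e_{i+1}$. For $e\in\mathbf{I}_n(\underline{01}0)$, an active site is a value $h\in\{0,\dots,n\}$ with $eh=e_1\dots e_nh\in\mathbf{I}_{n+1}(\underline{01}0)$. With the convention $e_0=0$ (used when $n=0$), $A_{>}(e)$ is the set of active sites $h$ with $h>e_n$ and $B_{\le}(e)$ the set of active sites $h$ with $h\le e_n$. -}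

module Defs where

open import Data.Nat using (ℕ; zero; suc; _+_; _∸_; _≤_; _<_; _>_; _≤?_; _<?_)
open import Data.Nat.Properties using (_≟_)
open import Data.Fin using (Fin; toℕ)
open import Data.Fin.Properties using (all?)
open import Data.Vec using (Vec; []; _∷_; _∷ʳ_; lookup)
open import Data.List using (List; filter; upTo; length; map)
open import Data.Product using (_×_; _,_)
open import Relation.Nullary using (¬_; Dec)
open import Relation.Nullary.Decidable using (¬?; _×-dec_; _→-dec_)
open import Relation.Binary.PropositionalEquality using (_≡_)

-- A sequence e₁ … eₙ is a Vec ℕ n; position i (1-based) is the Fin index with toℕ = i - 1.

IsInversionSeq : ∀ {n} → Vec ℕ n → Set
IsInversionSeq {n} e = ∀ (i : Fin n) → lookup e i < suc (toℕ i)

-- e avoids the vincular pattern 01̲0 (underlined 01): there are no positions i, j = i+1, k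
-- with i + 1 < k (i.e. j < k) and eᵢ = eₖ < eⱼ.
Avoids010 : ∀ {n} → Vec ℕ n → Set
Avoids010 {n} e = ∀ (i j k : Fin n) → toℕ j ≡ suc (toℕ i) → toℕ j < toℕ k →
  ¬ (lookup e i ≡ lookup e k × lookup e k < lookup e j)

InI010 : ∀ {n} → Vec ℕ n → Set
InI010 e = IsInversionSeq e × Avoids010 e

isInversionSeq? : ∀ {n} (e : Vec ℕ n) → Dec (IsInversionSeq e)
isInversionSeq? e = all? (λ i → lookup e i <? suc (toℕ i))

avoids010? : ∀ {n} (e : Vec ℕ n) → Dec (Avoids010 e)
avoids010? e = all? λ i → all? λ j → all? λ k →
  (toℕ j ≟ suc (toℕ i)) →-dec (toℕ j <? toℕ k) →-dec
    ¬? ((lookup e i ≟ lookup e k) ×-dec (lookup e k <? lookup e j))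

inI010? : ∀ {n} (e : Vec ℕ n) → Dec (InI010 e)
inI010? e = isInversionSeq? e ×-dec avoids010? e

activeSites : ∀ {n} → Vec ℕ n → List ℕ
activeSites {n} e = filter (λ h → inI010? (e ∷ʳ h)) (upTo (suc n))

-- Last entry eₙ, with the convention e₀ = 0 for the empty sequence.
lastEntry : ∀ {n} → Vec ℕ n → ℕ
lastEntry []           = 0
lastEntry (x ∷ [])     = x
lastEntry (_ ∷ y ∷ ys) = lastEntry (y ∷ ys)

A> : ∀ {n} → Vec ℕ n → List ℕ
A> e = filter (λ h → lastEntry e <? h) (activeSites e)

B≤ : ∀ {n} → Vec ℕ n → List ℕ
B≤ e = filter (λ h → h ≤? lastEntry e) (activeSites e)

label : ∀ {n} → Vec ℕ n → ℕ × ℕ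
label e = length (A> e) , length (B≤ e)

-- Call a value x "forbidden" for e = e₁…eₙ if x = eᵢ < eᵢ₊₁ for some i with i+1 < n.
-- For e ∈ 𝐈ₙ(01̲0), appending x keeps us in 𝐈ₙ₊₁(01̲0) exactly when x ≤ n and x is not
-- forbidden; and appending an active site h forbids, in addition, only the old last entry
-- c = eₙ, and only when c < h.  Hence, writing S for the (increasing) list of active sites
-- of e, the active sites of eh are the sites of S that survive (all of S if h ≤ c, S
-- without c if c < h), followed by the new value n+1.
--
-- The label of eh only depends on how many of these sites lie above / at or below h.
-- Splitting S = B' ++ c ∷ A around c, the sites h ∈ B' ++ [c] and h ∈ A are counted by a
-- general "rank profile" of a strictly increasing list: its i-th element has exactly i
-- elements at or below it and length − i above it.  This gives the two arithmetic
-- progressions of labels in the statement.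

module Submission where

open import Defs
open import Data.Nat using (ℕ; suc; _+_; _∸_)
open import Data.Vec using (Vec; []; _∷ʳ_)
open import Data.List using (map; _++_; applyUpTo)
open import Data.Product using (_×_; _,_)
open import Data.List.Relation.Binary.Permutation.Propositional using (_↭_)
open import Relation.Binary.PropositionalEquality using (_≡_)

open import Data.Nat using (zero; _≤_; _<_; _<?_; _≤?_; z≤n; s≤s; s≤s⁻¹)
open import Data.Nat.Properties
  using (_≟_; ≤-refl; <⇒≢; >⇒≢; <-irrefl; <-trans; ≤-<-trans; <⇒≤; <⇒≱; <⇒≯; ≤⇒≯; n<1+n; m<n⇒m<1+n;
         m<1+n⇒m<n∨m≡n; +-assoc; +-comm; +-identityʳ)
open import Data.Fin using (Fin; toℕ; fromℕ<) renaming (zero to fzero; suc to fsuc)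
open import Data.Fin.Properties using (toℕ-fromℕ<; toℕ<n)
open import Data.Vec using (_∷_; lookup)
open import Data.List using (List; []; _∷_; [_]; length; filter; upTo)
open import Data.List.Properties
  using (filter-all; filter-none; filter-accept; filter-reject; filter-++; length-++;
         map-++; map-cong-local; map-applyUpTo; applyUpTo-∷ʳ; ∷ʳ-++)
open import Data.List.Membership.Propositional using (_∈_)
open import Data.List.Membership.Propositional.Properties using (∈-∃++; ∈-filter⁺; ∈-filter⁻; ∈-upTo⁺; ∈-upTo⁻)
open import Data.List.Relation.Unary.Any using (here; there)
open import Data.List.Relation.Unary.All as All using (All; []; _∷_)
open import Data.List.Relation.Unary.All.Properties using (++⁻ˡ; ++⁻ʳ; ++⁻; ∷ʳ⁺)
open import Data.List.Relation.Unary.AllPairs using (AllPairs; []; _∷_)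
import Data.List.Relation.Unary.AllPairs.Properties as AllPairs
open import Data.List.Relation.Binary.Permutation.Propositional using (↭-trans; ↭-reflexive)
open import Data.List.Relation.Binary.Permutation.Propositional.Properties using (++-comm)
open import Data.Product using (Σ; proj₁; proj₂)
open import Data.Sum using (_⊎_; inj₁; inj₂)
open import Data.Empty using (⊥-elim)
open import Function using (_∘_; id)
open import Relation.Nullary using (¬_; Dec; yes; no)
open import Relation.Nullary.Decidable using (¬?; _×-dec_)
open import Relation.Unary using (Decidable)
open import Relation.Binary.PropositionalEquality using (refl; sym; trans; cong; cong₂; subst; subst₂; module ≡-Reasoning)

-- Positions are handled as natural numbers through a total entry function, which makes
-- appending an entry easy to describe; the Fin-indexed conditions of Defs are translated once.

-- Entry i (0-based) of a sequence; 0 outside the range.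
at : ∀ {n} → Vec ℕ n → ℕ → ℕ
at []       _       = 0
at (x ∷ _)  zero    = x
at (_ ∷ xs) (suc i) = at xs i

lookup-at : ∀ {n} (e : Vec ℕ n) (i : Fin n) → lookup e i ≡ at e (toℕ i)
lookup-at (x ∷ e) fzero    = refl
lookup-at (x ∷ e) (fsuc i) = lookup-at e i

at-lookup : ∀ {n} (e : Vec ℕ n) {i} (i<n : i < n) → at e i ≡ lookup e (fromℕ< i<n)
at-lookup e i<n = trans (cong (at e) (sym (toℕ-fromℕ< i<n))) (sym (lookup-at e _))

at-snoc : ∀ {n} (e : Vec ℕ n) x {i} → i < n → at (e ∷ʳ x) i ≡ at e i
at-snoc (y ∷ e) x {zero}  _         = refl
at-snoc (y ∷ e) x {suc i} (s≤s i<n) = at-snoc e x i<n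

at-snoc-new : ∀ {n} (e : Vec ℕ n) x → at (e ∷ʳ x) n ≡ x
at-snoc-new []      x = refl
at-snoc-new (y ∷ e) x = at-snoc-new e x

lastEntry-at : ∀ {n} (e : Vec ℕ n) → lastEntry e ≡ at e (n ∸ 1)
lastEntry-at []          = refl
lastEntry-at (x ∷ [])    = refl
lastEntry-at (x ∷ y ∷ e) = lastEntry-at (y ∷ e)

lastEntry-snoc : ∀ {n} (e : Vec ℕ n) x → lastEntry (e ∷ʳ x) ≡ x
lastEntry-snoc []          x = refl
lastEntry-snoc (y ∷ [])    x = refl
lastEntry-snoc (y ∷ z ∷ e) x = lastEntry-snoc (z ∷ e) x

Inversion : ∀ {n} → Vec ℕ n → Set
Inversion {n} e = ∀ {i} → i < n → at e i < suc i

Avoiding : ∀ {n} → Vec ℕ n → Set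
Avoiding {n} e = ∀ {i k} → suc i < k → k < n → ¬ (at e i ≡ at e k × at e k < at e (suc i))

fromI010 : ∀ {n} (e : Vec ℕ n) → InI010 e → Inversion e × Avoiding e
fromI010 {n} e (inv , avd) = inversion , avoiding
  where
  inversion : Inversion e
  inversion i<n = subst₂ (λ u v → u < suc v) (sym (at-lookup e i<n)) (toℕ-fromℕ< i<n) (inv (fromℕ< i<n))

  avoiding : Avoiding e
  avoiding {i} {k} 1+i<k k<n (eq , lt) =
    avd (fromℕ< i<n) (fromℕ< 1+i<n) (fromℕ< k<n)
        (trans (toℕ-fromℕ< 1+i<n) (cong suc (sym (toℕ-fromℕ< i<n))))
        (subst₂ _<_ (sym (toℕ-fromℕ< 1+i<n)) (sym (toℕ-fromℕ< k<n)) 1+i<k)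
        (subst₂ _≡_ (at-lookup e i<n) (at-lookup e k<n) eq ,
         subst₂ _<_ (at-lookup e k<n) (at-lookup e 1+i<n) lt)
    where
    1+i<n : suc i < n
    1+i<n = <-trans 1+i<k k<n
    i<n : i < n
    i<n = <-trans (n<1+n i) 1+i<n

toI010 : ∀ {n} (e : Vec ℕ n) → Inversion e → Avoiding e → InI010 e
toI010 e inv avd = inversion , avoiding
  where
  inversion : IsInversionSeq e
  inversion i rewrite lookup-at e i = inv (toℕ<n i)

  avoiding : Avoids010 e
  avoiding i j k j≡1+i j<k rewrite lookup-at e i | lookup-at e j | lookup-at e k | j≡1+i =
    avd j<k (toℕ<n k)

-- x is forbidden for e if x = eᵢ < eᵢ₊₁ at some position with i + 1 < n: appending x
-- would then create an occurrence of 01̲0.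
Forbidden : ∀ {n} → Vec ℕ n → ℕ → Set
Forbidden {n} e x = Σ ℕ λ i → suc i < n × at e i ≡ x × x < at e (suc i)

-- A forbidden value is an earlier entry, hence smaller than the length.
forbidden-bound : ∀ {n} (e : Vec ℕ n) {x} → Inversion e → Forbidden e x → x < n
forbidden-bound {n} e inv (i , 1+i<n , refl , _) = ≤-<-trans (s≤s⁻¹ (inv i<n)) i<n
  where
  i<n : i < n
  i<n = <-trans (n<1+n i) 1+i<n

forbidden-snoc : ∀ {n} (e : Vec ℕ n) h {x} → Forbidden (e ∷ʳ h) x →
                 Forbidden e x ⊎ (x ≡ lastEntry e × x < h)
forbidden-snoc {n} e h {x} (i , 1+i<1+n , eq , lt) with m<1+n⇒m<n∨m≡n 1+i<1+n
... | inj₁ 1+i<n = inj₁ (i , 1+i<n , trans (sym (at-snoc e h (<-trans (n<1+n i) 1+i<n))) eq ,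
                         subst (x <_) (at-snoc e h 1+i<n) lt)
... | inj₂ refl  = inj₂ (trans (sym eq) (trans (at-snoc e h (n<1+n i)) (sym (lastEntry-at e))) ,
                         subst (x <_) (at-snoc-new e h) lt)

forbidden-old : ∀ {n} (e : Vec ℕ n) h {x} → Forbidden e x → Forbidden (e ∷ʳ h) x
forbidden-old e h {x} (i , 1+i<n , eq , lt) =
  i , m<n⇒m<1+n 1+i<n , trans (at-snoc e h (<-trans (n<1+n i) 1+i<n)) eq ,
  subst (x <_) (sym (at-snoc e h 1+i<n)) lt

forbidden-last : ∀ {n} (e : Vec ℕ n) {h} → h < suc n → lastEntry e < h → Forbidden (e ∷ʳ h) (lastEntry e)
forbidden-last [] (s≤s z≤n) ()
forbidden-last {suc m} e {h} _ c<h =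
  m , ≤-refl , trans (at-snoc e h (n<1+n m)) (sym (lastEntry-at e)) ,
  subst (lastEntry e <_) (sym (at-snoc-new e h)) c<h

-- The last entry of e is never forbidden (that is exactly the avoidance of 01̲0 by e).
lastEntry-free : ∀ {n} (e : Vec ℕ n) → Avoiding e → ¬ Forbidden e (lastEntry e)
lastEntry-free {suc m} e avd (i , 1+i<1+m , eq , lt) rewrite lastEntry-at e
  with m<1+n⇒m<n∨m≡n 1+i<1+m
... | inj₁ 1+i<m = avd 1+i<m (n<1+n m) (eq , lt)
... | inj₂ refl  = <-irrefl refl lt

lastEntry-bound : ∀ {n} (e : Vec ℕ n) → Inversion e → lastEntry e < suc n
lastEntry-bound {zero}  []  _   = s≤s z≤n
lastEntry-bound {suc m} e inv rewrite lastEntry-at e = m<n⇒m<1+n (inv (n<1+n m))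

extension⇒ : ∀ {n} (e : Vec ℕ n) {x} → InI010 (e ∷ʳ x) → x < suc n × ¬ Forbidden e x
extension⇒ {n} e {x} valid = bound , free
  where
  inv : Inversion (e ∷ʳ x)
  inv = proj₁ (fromI010 (e ∷ʳ x) valid)
  avd : Avoiding (e ∷ʳ x)
  avd = proj₂ (fromI010 (e ∷ʳ x) valid)

  bound : x < suc n
  bound = subst (_< suc n) (at-snoc-new e x) (inv (n<1+n n))

  free : ¬ Forbidden e x
  free (i , 1+i<n , eq , lt) =
    avd 1+i<n (n<1+n n)
      (trans (at-snoc e x (<-trans (n<1+n i) 1+i<n)) (trans eq (sym (at-snoc-new e x))) ,
       subst₂ _<_ (sym (at-snoc-new e x)) (sym (at-snoc e x 1+i<n)) lt)

extension⇐ : ∀ {n} (e : Vec ℕ n) {x} → InI010 e → x < suc n → ¬ Forbidden e x → InI010 (e ∷ʳ x)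
extension⇐ {n} e {x} valid x<1+n free = toI010 (e ∷ʳ x) inversion avoiding
  where
  inv : Inversion e
  inv = proj₁ (fromI010 e valid)
  avd : Avoiding e
  avd = proj₂ (fromI010 e valid)

  inversion : Inversion (e ∷ʳ x)
  inversion {i} i<1+n with m<1+n⇒m<n∨m≡n i<1+n
  ... | inj₁ i<n = subst (_< suc i) (sym (at-snoc e x i<n)) (inv i<n)
  ... | inj₂ refl = subst (_< suc n) (sym (at-snoc-new e x)) x<1+n

  avoiding : Avoiding (e ∷ʳ x)
  avoiding {i} {k} 1+i<k k<1+n (eq , lt) with m<1+n⇒m<n∨m≡n k<1+n
  ... | inj₁ k<n = avd 1+i<k k<n
        (trans (sym (at-snoc e x i<n)) (trans eq (at-snoc e x k<n)) ,
         subst₂ _<_ (at-snoc e x k<n) (at-snoc e x 1+i<n) lt)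
    where
    1+i<n : suc i < n
    1+i<n = <-trans 1+i<k k<n
    i<n : i < n
    i<n = <-trans (n<1+n i) 1+i<n
  ... | inj₂ refl = free
        (i , 1+i<k , trans (sym (at-snoc e x (<-trans (n<1+n i) 1+i<k))) (trans eq (at-snoc-new e x)) ,
         subst₂ _<_ (at-snoc-new e x) (at-snoc e x 1+i<k) lt)

Sorted : List ℕ → Set
Sorted = AllPairs _<_

count : ∀ {A : Set} {P : A → Set} → Decidable P → List A → ℕ
count P? xs = length (filter P? xs)

profile : ℕ → List ℕ → ℕ × ℕ
profile h xs = count (h <?_) xs , count (_≤? h) xs

_⊕_ : ℕ × ℕ → ℕ × ℕ → ℕ × ℕ
(a , b) ⊕ (c , d) = a + c , b + d

count-++ : ∀ {A : Set} {P : A → Set} (P? : Decidable P) xs ys → count P? (xs ++ ys) ≡ count P? xs + count P? ys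
count-++ P? xs ys = trans (cong length (filter-++ P? xs ys)) (length-++ (filter P? xs))

profile-++ : ∀ h xs ys → profile h (xs ++ ys) ≡ profile h xs ⊕ profile h ys
profile-++ h xs ys = cong₂ _,_ (count-++ (h <?_) xs ys) (count-++ (_≤? h) xs ys)

profile-below : ∀ {h xs} → All (_≤ h) xs → profile h xs ≡ (0 , length xs)
profile-below {h} below =
  cong₂ _,_ (cong length (filter-none (h <?_) (All.map ≤⇒≯ below))) (cong length (filter-all (_≤? h) below))

profile-above : ∀ {h xs} → All (h <_) xs → profile h xs ≡ (length xs , 0)
profile-above {h} above =
  cong₂ _,_ (cong length (filter-all (h <?_) above)) (cong length (filter-none (_≤? h) (All.map <⇒≱ above)))

-- In a strictly increasing list L the i-th element (i = 1 … |L|) has i elements at or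
-- below it and |L| − i above it; stated for an arbitrary function of these two counts,
-- with the upper count shifted by k.
rank-profile : ∀ {X : Set} (f : ℕ → ℕ → X) k {L} → Sorted L →
               map (λ h → f (count (h <?_) L + k) (count (_≤? h) L)) L
                 ≡ map (λ i → f (length L + k ∸ i) i) (applyUpTo suc (length L))
rank-profile f k {[]}    []            = refl
rank-profile {X} f k {x ∷ L} (x<L ∷ sorted) = cong₂ _∷_ least others
  where
  open ≡-Reasoning
  N : ℕ
  N = length L

  -- x is the least element: all of L is above it and nothing else is below it.
  least : f (count (x <?_) (x ∷ L) + k) (count (_≤? x) (x ∷ L)) ≡ f (N + k) 1
  least = cong₂ f
    (cong (λ l → length l + k) (trans (filter-reject (x <?_) (<-irrefl refl)) (filter-all (x <?_) x<L)))
    (cong length (trans (filter-accept (_≤? x) ≤-refl) (cong (x ∷_) (filter-none (_≤? x) (All.map <⇒≱ x<L)))))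

  -- every later element y additionally has x below it.
  past-x : ∀ {y} → x < y →
           f (count (y <?_) (x ∷ L) + k) (count (_≤? y) (x ∷ L)) ≡ f (count (y <?_) L + k) (suc (count (_≤? y) L))
  past-x {y} x<y = cong₂ f (cong (λ l → length l + k) (filter-reject (y <?_) (<⇒≯ x<y)))
                           (cong length (filter-accept (_≤? y) (<⇒≤ x<y)))

  g : ℕ → X
  g i = f (suc N + k ∸ i) i

  others : map (λ h → f (count (h <?_) (x ∷ L) + k) (count (_≤? h) (x ∷ L))) L ≡ map g (applyUpTo (suc ∘ suc) N)
  others = begin
    map (λ h → f (count (h <?_) (x ∷ L) + k) (count (_≤? h) (x ∷ L))) L
      ≡⟨ map-cong-local (All.map past-x x<L) ⟩
    map (λ h → f (count (h <?_) L + k) (suc (count (_≤? h) L))) L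
      ≡⟨ rank-profile (λ u v → f u (suc v)) k sorted ⟩
    map (g ∘ suc) (applyUpTo suc N)
      ≡⟨ map-applyUpTo suc (g ∘ suc) N ⟩
    applyUpTo (g ∘ suc ∘ suc) N
      ≡⟨ map-applyUpTo (suc ∘ suc) g N ⟨
    map g (applyUpTo (suc ∘ suc) N)
      ∎

filter-refine : ∀ {A : Set} {P Q R : A → Set} (P? : Decidable P) (Q? : Decidable Q) (R? : Decidable R) xs →
                (∀ {x} → x ∈ xs → R x → P x × Q x) → (∀ {x} → x ∈ xs → P x → Q x → R x) →
                filter R? xs ≡ filter Q? (filter P? xs)
filter-refine P? Q? R? []       _  _    = refl
filter-refine P? Q? R? (x ∷ xs) to from with R? x | P? x
... | yes r | yes _ = trans (cong (x ∷_) (filter-refine P? Q? R? xs (to ∘ there) (from ∘ there)))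
                           (sym (filter-accept Q? (proj₂ (to (here refl) r))))
... | yes r | no ¬p = ⊥-elim (¬p (proj₁ (to (here refl) r)))
... | no ¬r | yes p = trans (filter-refine P? Q? R? xs (to ∘ there) (from ∘ there))
                           (sym (filter-reject Q? (¬r ∘ from (here refl) p)))
... | no _  | no _  = filter-refine P? Q? R? xs (to ∘ there) (from ∘ there)

split-sorted : ∀ xs {y ys} → Sorted (xs ++ y ∷ ys) → All (_< y) xs × Sorted xs × All (y <_) ys × Sorted ys
split-sorted []       (y<ys ∷ sorted) = [] , [] , y<ys , sorted
split-sorted (x ∷ xs) (x<rest ∷ sorted) with below , sortedxs , above , sortedys ← split-sorted xs sorted =
  All.head (++⁻ʳ xs x<rest) ∷ below , ++⁻ˡ xs x<rest ∷ sortedxs , above , sortedys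

-- After appending h, a site x survives unless it is the old last entry c and c < h.
survives? : ∀ c h x → Dec (¬ (x ≡ c × c < h))
survives? c h x = ¬? ((x ≟ c) ×-dec (c <? h))

survivors : ℕ → ℕ → List ℕ → List ℕ
survivors c h = filter (survives? c h)

survivors-≤ : ∀ {c h} → ¬ c < h → ∀ xs → survivors c h xs ≡ xs
survivors-≤ c≮h xs = filter-all (survives? _ _) (All.universal (λ _ → c≮h ∘ proj₂) xs)

survivors-> : ∀ {c h} → c < h → ∀ {B' A} → All (_< c) B' → All (c <_) A → survivors c h (B' ++ c ∷ A) ≡ B' ++ A
survivors-> {c} {h} c<h {B'} {A} below above = begin
  survivors c h (B' ++ c ∷ A)                ≡⟨ filter-++ (survives? c h) B' (c ∷ A) ⟩
  survivors c h B' ++ survivors c h (c ∷ A)  ≡⟨ cong₂ _++_ (filter-all (survives? c h) (All.map (kept ∘ <⇒≢) below))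
                                                           (filter-reject (survives? c h) (λ kept-c → kept-c (refl , c<h))) ⟩
  B' ++ survivors c h A                      ≡⟨ cong (B' ++_) (filter-all (survives? c h) (All.map (kept ∘ >⇒≢) above)) ⟩
  B' ++ A                                    ∎
  where
  open ≡-Reasoning
  kept : ∀ {x} → ¬ x ≡ c → ¬ (x ≡ c × c < h)
  kept x≢c = x≢c ∘ proj₁

-- Below, S = B' ++ c ∷ A is increasing, c plays the old last entry and m the new value n + 1.
-- The old last entry has the sites of A above it and those of B' and itself below it.
profile-split-point : ∀ {c B' A} → All (_< c) B' → All (c <_) A → profile c (B' ++ c ∷ A) ≡ (length A , suc (length B'))
profile-split-point {c} {B'} {A} below above = begin
  profile c (B' ++ c ∷ A)                           ≡⟨ profile-++ c B' (c ∷ A) ⟩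
  profile c B' ⊕ profile c ([ c ] ++ A)             ≡⟨ cong (profile c B' ⊕_) (profile-++ c [ c ] A) ⟩
  profile c B' ⊕ (profile c [ c ] ⊕ profile c A)    ≡⟨ cong₂ _⊕_ (profile-below {c} (All.map <⇒≤ below))
                                                              (cong₂ _⊕_ (profile-below {c} (≤-refl ∷ [])) (profile-above above)) ⟩
  (length A , length B' + 1)                        ≡⟨ cong (length A ,_) (+-comm (length B') 1) ⟩
  (length A , suc (length B'))                      ∎
  where open ≡-Reasoning

-- A site h above c: c is no longer active, B' lies below h and m above it.
profile-upper : ∀ {c h m B' A} → c < h → h < m → All (_< c) B' → All (c <_) A →
                profile h (survivors c h (B' ++ c ∷ A) ++ [ m ]) ≡ (count (h <?_) A + 1 , length B' + count (_≤? h) A)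
profile-upper {c} {h} {m} {B'} {A} c<h h<m below above = begin
  profile h (survivors c h (B' ++ c ∷ A) ++ [ m ])    ≡⟨ cong (λ l → profile h (l ++ [ m ])) (survivors-> c<h below above) ⟩
  profile h ((B' ++ A) ++ [ m ])                      ≡⟨ profile-++ h (B' ++ A) [ m ] ⟩
  profile h (B' ++ A) ⊕ profile h [ m ]               ≡⟨ cong₂ _⊕_ (profile-++ h B' A) (profile-above (h<m ∷ [])) ⟩
  (profile h B' ⊕ profile h A) ⊕ (1 , 0)              ≡⟨ cong (λ p → (p ⊕ profile h A) ⊕ (1 , 0)) (profile-below B'≤h) ⟩
  (count (h <?_) A + 1 , length B' + count (_≤? h) A + 0)
                                                      ≡⟨ cong (count (h <?_) A + 1 ,_) (+-identityʳ _) ⟩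
  (count (h <?_) A + 1 , length B' + count (_≤? h) A) ∎
  where
  open ≡-Reasoning
  B'≤h : All (_≤ h) B'
  B'≤h = All.map (λ x<c → <⇒≤ (<-trans x<c c<h)) below

-- A site h at or below c: every site stays active and A lies above h, as does m.
profile-lower : ∀ {c h m B' A} → h ≤ c → h < m → All (c <_) A →
                profile h (survivors c h (B' ++ c ∷ A) ++ [ m ])
                  ≡ (count (h <?_) (B' ++ [ c ]) + (length A + 1) , count (_≤? h) (B' ++ [ c ]))
profile-lower {c} {h} {m} {B'} {A} h≤c h<m above = begin
  profile h (survivors c h (B' ++ c ∷ A) ++ [ m ])    ≡⟨ cong (λ l → profile h (l ++ [ m ]))
                                                              (trans (survivors-≤ (≤⇒≯ h≤c) _) (sym (∷ʳ-++ B' c A))) ⟩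
  profile h ((B ++ A) ++ [ m ])                       ≡⟨ profile-++ h (B ++ A) [ m ] ⟩
  profile h (B ++ A) ⊕ profile h [ m ]                ≡⟨ cong₂ _⊕_ (profile-++ h B A) (profile-above (h<m ∷ [])) ⟩
  (profile h B ⊕ profile h A) ⊕ (1 , 0)               ≡⟨ cong (λ p → (profile h B ⊕ p) ⊕ (1 , 0)) (profile-above A>h) ⟩
  (count (h <?_) B + length A + 1 , count (_≤? h) B + 0 + 0)
                                                      ≡⟨ cong₂ _,_ (+-assoc (count (h <?_) B) (length A) 1)
                                                                   (trans (+-identityʳ _) (+-identityʳ _)) ⟩
  (count (h <?_) B + (length A + 1) , count (_≤? h) B) ∎
  where
  open ≡-Reasoning
  B : List ℕ
  B = B' ++ [ c ]
  A>h : All (h <_) A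
  A>h = All.map (≤-<-trans h≤c) above

-- The profiles of all sites h ∈ S within the list of sites surviving h, followed by m:
-- the sites above c give the first progression, those at or below c the second.
extension-profile : ∀ {S c m a b} → Sorted S → c ∈ S → All (_< m) S → profile c S ≡ (a , b) →
  map (λ h → profile h (survivors c h S ++ [ m ])) S
    ↭ (map (λ i → (a + 1 ∸ i , b + i ∸ 1)) (applyUpTo suc a)
       ++ map (λ i → (a + b + 1 ∸ i , i)) (applyUpTo suc b))
extension-profile {c = c} {m} sorted c∈S bounded eq
  with B' , A , refl ← ∈-∃++ c∈S
  with below , sortedB' , above , sortedA ← split-sorted B' sorted
  with refl ← trans (sym eq) (profile-split-point below above) =
  ↭-trans (↭-reflexive (begin
    map F (B' ++ c ∷ A)          ≡⟨ cong (map F) (sym (∷ʳ-++ B' c A)) ⟩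
    map F (B ++ A)               ≡⟨ map-++ F B A ⟩
    map F B ++ map F A           ≡⟨ cong₂ _++_ lower upper ⟩
    lowerLabels ++ upperLabels   ∎))
    (++-comm lowerLabels upperLabels)
  where
  open ≡-Reasoning
  F : ℕ → ℕ × ℕ
  F h = profile h (survivors c h (B' ++ c ∷ A) ++ [ m ])
  B : List ℕ
  B = B' ++ [ c ]
  lA lB : ℕ
  lA = length A
  lB = length B'
  upperLabels lowerLabels : List (ℕ × ℕ)
  upperLabels = map (λ i → (lA + 1 ∸ i , lB + i)) (applyUpTo suc lA)
  lowerLabels = map (λ i → (lA + suc lB + 1 ∸ i , i)) (applyUpTo suc (suc lB))

  sortedB : Sorted B
  sortedB = AllPairs.++⁺ sortedB' ([] ∷ []) (All.map (_∷ []) below)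
  B≤c : All (_≤ c) B
  B≤c = ∷ʳ⁺ (All.map <⇒≤ below) ≤-refl
  B<m×A<m : All (_< m) B × All (_< m) A
  B<m×A<m = ++⁻ B (subst (All (_< m)) (sym (∷ʳ-++ B' c A)) bounded)

  upper : map F A ≡ upperLabels
  upper = trans (map-cong-local (All.zipWith (λ (c<h , h<m) → profile-upper c<h h<m below above) (above , proj₂ B<m×A<m)))
                (rank-profile (λ u v → (u , lB + v)) 1 sortedA)

  length-B : length B ≡ suc lB
  length-B = trans (length-++ B') (+-comm lB 1)

  lower : map F B ≡ lowerLabels
  lower = begin
    map F B
      ≡⟨ map-cong-local (All.zipWith (λ (h≤c , h<m) → profile-lower {B' = B'} h≤c h<m above) (B≤c , proj₁ B<m×A<m)) ⟩
    map (λ h → (count (h <?_) B + (lA + 1) , count (_≤? h) B)) B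
      ≡⟨ rank-profile _,_ (lA + 1) sortedB ⟩
    map (λ i → (length B + (lA + 1) ∸ i , i)) (applyUpTo suc (length B))
      ≡⟨ cong₂ (λ N l → map (λ i → (N ∸ i , i)) (applyUpTo suc l)) total length-B ⟩
    lowerLabels
      ∎
    where
    total : length B + (lA + 1) ≡ lA + suc lB + 1
    total = begin
      length B + (lA + 1)   ≡⟨ cong (_+ (lA + 1)) length-B ⟩
      suc lB + (lA + 1)     ≡⟨ +-assoc (suc lB) lA 1 ⟨
      suc lB + lA + 1       ≡⟨ cong (_+ 1) (+-comm (suc lB) lA) ⟩
      lA + suc lB + 1       ∎

active? : ∀ {n} (e : Vec ℕ n) x → Dec (InI010 (e ∷ʳ x))
active? e x = inI010? (e ∷ʳ x)

active-valid : ∀ {n} (e : Vec ℕ n) {h} → h ∈ activeSites e → InI010 (e ∷ʳ h)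
active-valid e h∈S = proj₂ (∈-filter⁻ (active? e) h∈S)

activeSites-sorted : ∀ {n} (e : Vec ℕ n) → Sorted (activeSites e)
activeSites-sorted {n} e = AllPairs.filter⁺ (active? e) (AllPairs.applyUpTo⁺₁ id (suc n) (λ i<j _ → i<j))

activeSites-bounded : ∀ {n} (e : Vec ℕ n) → All (_< suc n) (activeSites e)
activeSites-bounded e = All.tabulate (λ h∈S → ∈-upTo⁻ (proj₁ (∈-filter⁻ (active? e) h∈S)))

lastEntry-active : ∀ {n} (e : Vec ℕ n) → InI010 e → lastEntry e ∈ activeSites e
lastEntry-active {n} e valid = ∈-filter⁺ (active? e) (∈-upTo⁺ bound) (extension⇐ e valid bound (lastEntry-free e avd))
  where
  bound : lastEntry e < suc n
  bound = lastEntry-bound e (proj₁ (fromI010 e valid))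
  avd : Avoiding e
  avd = proj₂ (fromI010 e valid)

activeSites-snoc : ∀ {n} (e : Vec ℕ n) → InI010 e → ∀ {h} → h ∈ activeSites e →
                   activeSites (e ∷ʳ h) ≡ survivors (lastEntry e) h (activeSites e) ++ [ suc n ]
activeSites-snoc {n} e valid {h} h∈S = begin
  filter (active? e') (upTo (suc (suc n)))
    ≡⟨ cong (filter (active? e')) (sym (applyUpTo-∷ʳ id (suc n))) ⟩
  filter (active? e') (upTo (suc n) ++ [ suc n ])
    ≡⟨ filter-++ (active? e') (upTo (suc n)) [ suc n ] ⟩
  filter (active? e') (upTo (suc n)) ++ filter (active? e') [ suc n ]
    ≡⟨ cong₂ _++_ (filter-refine (active? e) (survives? c h) (active? e') (upTo (suc n)) restrict extend)
                  (filter-accept (active? e') new-active) ⟩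
  survivors c h (activeSites e) ++ [ suc n ]
    ∎
  where
  open ≡-Reasoning
  c : ℕ
  c = lastEntry e
  e' : Vec ℕ (suc n)
  e' = e ∷ʳ h
  valid' : InI010 e'
  valid' = active-valid e h∈S
  h<1+n : h < suc n
  h<1+n = proj₁ (extension⇒ e valid')

  -- n + 1 exceeds every forbidden value of e', so it is always active.
  new-active : InI010 (e' ∷ʳ suc n)
  new-active = extension⇐ e' valid' ≤-refl
                 (λ f → <-irrefl refl (forbidden-bound e' (proj₁ (fromI010 e' valid')) f))

  restrict : ∀ {x} → x ∈ upTo (suc n) → InI010 (e' ∷ʳ x) → InI010 (e ∷ʳ x) × ¬ (x ≡ c × c < h)
  restrict {x} x∈ v = extension⇐ e valid (∈-upTo⁻ x∈) (free ∘ forbidden-old e h) ,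
                      λ { (refl , c<h) → free (forbidden-last e h<1+n c<h) }
    where
    free : ¬ Forbidden e' x
    free = proj₂ (extension⇒ e' v)

  extend : ∀ {x} → x ∈ upTo (suc n) → InI010 (e ∷ʳ x) → ¬ (x ≡ c × c < h) → InI010 (e' ∷ʳ x)
  extend {x} x∈ v kept = extension⇐ e' valid' (m<n⇒m<1+n (∈-upTo⁻ x∈)) free
    where
    free : ¬ Forbidden e' x
    free f with forbidden-snoc e h f
    ... | inj₁ old          = proj₂ (extension⇒ e v) old
    ... | inj₂ (refl , c<h) = kept (refl , c<h)

label-extension : ∀ {n} (e : Vec ℕ n) → InI010 e → ∀ {h} → h ∈ activeSites e →
                  label (e ∷ʳ h) ≡ profile h (survivors (lastEntry e) h (activeSites e) ++ [ suc n ])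
label-extension e valid h∈S = cong₂ profile (lastEntry-snoc e _) (activeSites-snoc e valid h∈S)

proposition3p15 :
    label [] ≡ (0 , 1)
    × (∀ (n : ℕ) (e : Vec ℕ n) → InI010 e → ∀ (a b : ℕ) → label e ≡ (a , b) →
        map (λ h → label (e ∷ʳ h)) (activeSites e)
          ↭ (map (λ i → (a + 1 ∸ i , b + i ∸ 1)) (applyUpTo suc a)
             ++ map (λ i → (a + b + 1 ∸ i , i)) (applyUpTo suc b)))
-- The root label is computed directly; the rest is extension-profile for S = activeSites e.
proposition3p15 = refl , λ n e valid a b label≡ →
  ↭-trans (↭-reflexive (map-cong-local (All.tabulate (label-extension e valid))))
          (extension-profile (activeSites-sorted e) (lastEntry-active e valid) (activeSites-bounded e) label≡)
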